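{- Let $q\in\mathbb{Z}[\varepsilon]=\{x+\varepsilon y: x,y\in\mathbb{Z}\}$ and let $\mathfrak{N}_0^{\mathbb{A}}=\{0,1,\dots,N_{\mathbb{A}}(q)-1\}=\{0,1,\dots,(\mathrm{Re}(q))^2-1\}$. Then $(q,\mathfrak{N}_0^{\mathbb{A}})$ is a number system for $\mathbb{Z}[\varepsilon]$ if and only if $q=a\pm\varepsilon$ with $a\in\mathbb{Z}$, $a\le -2$.
   Context: The dual numbers are $\mathbb{A}=\{x+\varepsilon y: x,y\in\mathbb{R}\}$ with $\varepsilon\notin\mathbb{R}$, $\varepsilon^2=0$; for $z=x+\varepsilon y$, $\mathrm{Re}(z)=x$ and $N_{\mathbb{A}}(z)=x^2$. $\mathbb{Z}[\varepsilon]$ is the ring of dual Gaussian integers. For a commutative ring $R$, $q\in R$ and $\mathfrak{N}\subset R$, the pair $(q,\mathfrak{N})$ is a number system for $R$ if $\mathfrak{N}$ is a complete residue system modulo $q$ in $R$ (every $\alpha\in R$ is congruent modulo $q$, i.e. $q\mid\alpha-r$ in $R$, to exactly one $r\in\mathfrak{N}$) and every $\alpha\in R$ can be written as $\alpha=r_0+r_1q+\cdots+r_kq^k$ with $r_i\in\mathfrak{N}$. -}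

module Defs where

open import Data.Nat as ℕ using (ℕ)
open import Data.Integer as ℤ using (ℤ; +_; _+_; _*_; -_; _-_; _≤_)
open import Data.List using (List; []; _∷_)
open import Data.List.Relation.Unary.All using (All)
open import Data.Product using (Σ; ∃; _×_; _,_)
open import Relation.Binary.PropositionalEquality using (_≡_)

-- Dual Gaussian integers  x + ε y  with ε² = 0
record ℤ[ε] : Set where
  constructor _+ε_
  field
    re : ℤ
    du : ℤ
open ℤ[ε] public

infixl 6 _⊕_ _⊖_
infixl 7 _⊛_

_⊕_ : ℤ[ε] → ℤ[ε] → ℤ[ε]
(a +ε b) ⊕ (c +ε d) = (a + c) +ε (b + d)

_⊖_ : ℤ[ε] → ℤ[ε] → ℤ[ε]
(a +ε b) ⊖ (c +ε d) = (a - c) +ε (b - d)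

_⊛_ : ℤ[ε] → ℤ[ε] → ℤ[ε]
(a +ε b) ⊛ (c +ε d) = (a * c) +ε (a * d + b * c)

ι : ℤ → ℤ[ε]
ι x = x +ε (+ 0)

_∣ε_ : ℤ[ε] → ℤ[ε] → Set
q ∣ε α = ∃ λ γ → α ≡ q ⊛ γ

Nrm : ℤ[ε] → ℕ
Nrm q = ℤ.∣ re q ∣ ℕ.* ℤ.∣ re q ∣

𝔑₀ : ℤ[ε] → ℤ[ε] → Set
𝔑₀ q r = ∃ λ (n : ℕ) → (n ℕ.< Nrm q) × (r ≡ ι (+ n))

-- value of r₀ + r₁ q + … + r_k q^k  (Horner)
eval : ℤ[ε] → List ℤ[ε] → ℤ[ε]
eval q [] = ι (+ 0)
eval q (r ∷ rs) = r ⊕ q ⊛ eval q rs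

CompleteResidueSystem : ℤ[ε] → (ℤ[ε] → Set) → Set
CompleteResidueSystem q 𝔑 =
  ∀ α → ∃ λ r → 𝔑 r × (q ∣ε (α ⊖ r)) ×
        (∀ r' → 𝔑 r' → q ∣ε (α ⊖ r') → r' ≡ r)

IsNumberSystem : ℤ[ε] → (ℤ[ε] → Set) → Set
IsNumberSystem q 𝔑 =
  CompleteResidueSystem q 𝔑 ×
  (∀ α → ∃ λ (ds : List ℤ[ε]) → All 𝔑 ds × α ≡ eval q ds)

-- Necessity. The digits are rational integers, so the real part of an expansion in base q
-- is Σ nₖ (Re q)ᵏ, which is nonnegative when Re q ≥ 0 and vanishes when Re q = -1 (the
-- only digit then being 0), while its ε-part is a multiple of the ε-coefficient b of q;
-- expanding -1, 1 and ε respectively rules out everything but Re q ≤ -2 and b = ±1.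
--
-- Sufficiency. Conjugation x + εy ↦ x - εy fixes the digits, so take q = -M + ε, M ≥ 2.
-- Then q ∣ x + εy iff M² ∣ x + My, so {0, …, M² - 1} is a complete residue system, and
-- division x + εy = n + q (x′ + εy′) with a digit n means M x′ = n - x and M y′ = x′ - y.
-- The first equation pulls x into the strip [-1, M], which it never leaves again; on the
-- strip the second shrinks |y| until y ∈ {-1, 0, 1}, and these are expanded by hand.
module Submission where

open import Defs
open import Data.Nat as ℕ using (ℕ; zero; suc)
import Data.Nat.Properties as ℕ
open import Data.Integer as ℤ
  using (ℤ; +_; -[1+_]; +[1+_]; -_; _+_; _-_; _*_; 0ℤ; 1ℤ; -1ℤ; _≤_; _<_; +≤+; -≤+; -≤-; +<+; ∣_∣;
         NonZero; Positive)
open import Data.Integer.Properties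
open import Data.Integer.DivMod using (_%ℕ_; _/ℕ_; n%ℕd<d; a≡a%ℕn+[a/ℕn]*n)
open import Data.Integer.Tactic.RingSolver using (solve)
open import Data.Empty using (⊥-elim)
open import Data.List using (List; []; _∷_)
open import Data.List.Relation.Unary.All as All using (All)
open import Data.Product using (∃; _×_; _,_; uncurry)
open import Data.Sum as Sum using (_⊎_; inj₁; inj₂)
open import Function.Base using (_∘_; case_of_)
open import Function.Bundles using (_⇔_; mk⇔; Equivalence)
open import Relation.Nullary using (¬_; yes; no)
open import Relation.Binary.PropositionalEquality

half≤pred : ∀ {i f} → i ℕ.+ i ℕ.≤ f → i ℕ.≤ ℕ.pred f
half≤pred {zero} _ = ℕ.z≤n
half≤pred {suc i} {suc f} (ℕ.s≤s i+1+i≤f) = ℕ.≤-trans (ℕ.m≤n+m (suc i) i) i+1+i≤f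

2+2i≤3+j⇒i≤j : ∀ {i j} → suc i ℕ.+ suc i ℕ.≤ 3 ℕ.+ j → i ℕ.≤ j
2+2i≤3+j⇒i≤j {i} {j} 2+2i≤3+j =
  half≤pred (ℕ.s≤s⁻¹ (subst (ℕ._≤ suc (suc j)) (ℕ.+-suc i i) (ℕ.s≤s⁻¹ 2+2i≤3+j)))

i≤+∣i∣ : ∀ i → i ≤ + ∣ i ∣
i≤+∣i∣ (+ _) = ≤-refl
i≤+∣i∣ -[1+ _ ] = -≤+

i-1<i : ∀ i → i - 1ℤ < i
i-1<i i = suc[i]≤j⇒i<j (≤-reflexive 1+[i-1]≡i)
  where
  1+[i-1]≡i : 1ℤ + (i - 1ℤ) ≡ i
  1+[i-1]≡i = solve (i ∷ [])

0≰-[1+n] : ∀ {n} → ¬ (0ℤ ≤ -[1+ n ])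
0≰-[1+n] ()

1+n≰0 : ∀ {n} → ¬ (+[1+ n ] ≤ 0ℤ)
1+n≰0 (+≤+ ())

0≤i*j : ∀ {i j} → 0ℤ ≤ i → 0ℤ ≤ j → 0ℤ ≤ i * j
0≤i*j {+ m} {+ n} _ _ = subst (0ℤ ≤_) (pos-* m n) (+≤+ ℕ.z≤n)

≤-by-nonpos : ∀ {a b c} → a ≡ b + c → b ≤ 0ℤ → a ≤ c
≤-by-nonpos {c = c} refl b≤0 = ≤-trans (+-monoˡ-≤ c b≤0) (≤-reflexive (+-identityˡ c))

∣i∣≡1⇒i≡±1 : ∀ i → ∣ i ∣ ≡ 1 → i ≡ 1ℤ ⊎ i ≡ -1ℤ
∣i∣≡1⇒i≡±1 (+ 1) _ = inj₁ refl
∣i∣≡1⇒i≡±1 -[1+ 0 ] _ = inj₂ refl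
∣i∣≡1⇒i≡±1 (+ 0) ()
∣i∣≡1⇒i≡±1 +[1+ suc _ ] ()
∣i∣≡1⇒i≡±1 -[1+ suc _ ] ()

+n≢+n′+[1+j]*D : ∀ {D n} n′ j → n ℕ.< D → + n ≢ + n′ + +[1+ j ] * + D
+n≢+n′+[1+j]*D {D} {n} n′ j n<D n≡ = <-irrefl n≡ (begin-strict
  + n                     <⟨ +<+ n<D ⟩
  + D                     ≡⟨ *-identityˡ (+ D) ⟨
  + 1 * + D               ≤⟨ *-monoʳ-≤-nonNeg (+ D) {+ 1} {+[1+ j ]} (+≤+ (ℕ.s≤s ℕ.z≤n)) ⟩
  +[1+ j ] * + D          ≤⟨ i≤j⇒i≤k+j (+ n′) ≤-refl ⟩
  + n′ + +[1+ j ] * + D   ∎)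
  where open ≤-Reasoning

residue-unique : ∀ {D n n′} s → n ℕ.< D → n′ ℕ.< D → + n ≡ + n′ + s * + D → n ≡ n′
residue-unique {D} {n} {n′} (+ 0) _ _ n≡ = +-injective (begin
  + n               ≡⟨ n≡ ⟩
  + n′ + + 0 * + D  ≡⟨ cong (_+_ (+ n′)) (*-zeroˡ (+ D)) ⟩
  + n′ + + 0        ≡⟨ +-identityʳ (+ n′) ⟩
  + n′              ∎)
  where open ≡-Reasoning
residue-unique +[1+ j ] n<D _ n≡ = ⊥-elim (+n≢+n′+[1+j]*D _ j n<D n≡)
residue-unique {D} {n} {n′} -[1+ j ] _ n′<D n≡ =
  ⊥-elim (+n≢+n′+[1+j]*D _ j n′<D (swap (+ n) (+ n′) +[1+ j ] (+ D) n≡))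
  where
  swap : ∀ N N′ S D → N ≡ N′ + (- S) * D → N′ ≡ N + S * D
  swap N N′ S D N≡ = begin
    N′                         ≡⟨ solve (N′ ∷ S ∷ D ∷ []) ⟩
    (N′ + (- S) * D) + S * D   ≡⟨ cong (_+ S * D) N≡ ⟨
    N + S * D                  ∎
    where open ≡-Reasoning

Representable : ℤ[ε] → ℤ[ε] → Set
Representable q α = ∃ λ (ds : List ℤ[ε]) → All (𝔑₀ q) ds × α ≡ eval q ds

conj : ℤ[ε] → ℤ[ε]
conj (x +ε y) = x +ε (- y)

conj-involutive : ∀ α → conj (conj α) ≡ α
conj-involutive (x +ε y) = cong (x +ε_) (neg-involutive y)

conj-⊕ : ∀ α β → conj (α ⊕ β) ≡ conj α ⊕ conj β
conj-⊕ (x +ε y) (u +ε v) = cong (_+ε_ (x + u)) (neg-distrib-+ y v)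

conj-⊖ : ∀ α β → conj (α ⊖ β) ≡ conj α ⊖ conj β
conj-⊖ (x +ε y) (u +ε v) = cong (_+ε_ (x - u)) (neg-distrib-+ y (- v))

conj-⊛ : ∀ α β → conj (α ⊛ β) ≡ conj α ⊛ conj β
conj-⊛ (x +ε y) (u +ε v) = cong (_+ε_ (x * u)) du≡
  where
  du≡ : - (x * v + y * u) ≡ x * - v + - y * u
  du≡ = solve (x ∷ y ∷ u ∷ v ∷ [])

∣ε-conj : ∀ {q α} → q ∣ε α → conj q ∣ε conj α
∣ε-conj {q} (γ , α≡qγ) = conj γ , trans (cong conj α≡qγ) (conj-⊛ q γ)

eval-conj : ∀ q ds → All (𝔑₀ q) ds → conj (eval q ds) ≡ eval (conj q) ds
eval-conj q [] All.[] = refl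
eval-conj q (_ ∷ ds) ((n , _ , refl) All.∷ digits) = begin
  conj (ι (+ n) ⊕ q ⊛ eval q ds)        ≡⟨ conj-⊕ (ι (+ n)) (q ⊛ eval q ds) ⟩
  ι (+ n) ⊕ conj (q ⊛ eval q ds)        ≡⟨ cong (ι (+ n) ⊕_) (conj-⊛ q (eval q ds)) ⟩
  ι (+ n) ⊕ conj q ⊛ conj (eval q ds)   ≡⟨ cong (λ β → ι (+ n) ⊕ conj q ⊛ β) (eval-conj q ds digits) ⟩
  ι (+ n) ⊕ conj q ⊛ eval (conj q) ds   ∎
  where open ≡-Reasoning

number-system-conj : ∀ q → IsNumberSystem q (𝔑₀ q) → IsNumberSystem (conj q) (𝔑₀ (conj q))
number-system-conj q (residues , expansions) = residues′ , expansions′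
  where
  conj-residue : ∀ q α n → q ∣ε (α ⊖ ι (+ n)) → conj q ∣ε (conj α ⊖ ι (+ n))
  conj-residue q α n q∣ = subst (conj q ∣ε_) (conj-⊖ α (ι (+ n))) (∣ε-conj {q} {α ⊖ ι (+ n)} q∣)

  residues′ : CompleteResidueSystem (conj q) (𝔑₀ (conj q))
  residues′ α with residues (conj α)
  ... | _ , (n , n<N , refl) , q∣ , unique =
    ι (+ n) , (n , n<N , refl) ,
    subst (λ β → conj q ∣ε (β ⊖ ι (+ n))) (conj-involutive α) (conj-residue q (conj α) n q∣) ,
    λ { _ (n′ , n′<N , refl) q∣′ →
          unique (ι (+ n′)) (n′ , n′<N , refl)
                 (subst (_∣ε (conj α ⊖ ι (+ n′))) (conj-involutive q) (conj-residue (conj q) α n′ q∣′)) }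

  expansions′ : ∀ α → Representable (conj q) α
  expansions′ α with expansions (conj α)
  ... | ds , digits , conjα≡ = ds , digits , (begin
    α                  ≡⟨ conj-involutive α ⟨
    conj (conj α)      ≡⟨ cong conj conjα≡ ⟩
    conj (eval q ds)   ≡⟨ eval-conj q ds digits ⟩
    eval (conj q) ds   ∎)
    where open ≡-Reasoning

re-eval-nonneg : ∀ {q} ds → 0ℤ ≤ re q → All (𝔑₀ q) ds → 0ℤ ≤ re (eval q ds)
re-eval-nonneg [] _ All.[] = ≤-refl
re-eval-nonneg (_ ∷ ds) 0≤re ((n , _ , refl) All.∷ digits) =
  +-mono-≤ (+≤+ ℕ.z≤n) (0≤i*j 0≤re (re-eval-nonneg ds 0≤re digits))

re-eval≡0 : ∀ {b} ds → All (𝔑₀ (-1ℤ +ε b)) ds → re (eval (-1ℤ +ε b) ds) ≡ 0ℤ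
re-eval≡0 [] All.[] = refl
re-eval≡0 (_ ∷ ds) ((0 , _ , refl) All.∷ digits) = cong (λ r → + 0 + -1ℤ * r) (re-eval≡0 ds digits)
re-eval≡0 (_ ∷ ds) ((suc _ , ℕ.s≤s () , refl) All.∷ _)

du-eval-multiple : ∀ {a b} ds → All (𝔑₀ (a +ε b)) ds → ∃ λ t → du (eval (a +ε b) ds) ≡ b * t
du-eval-multiple {b = b} [] All.[] = 0ℤ , sym (*-zeroʳ b)
du-eval-multiple {a} {b} (_ ∷ ds) ((n , _ , refl) All.∷ digits) with du-eval-multiple ds digits
... | t , du≡bt = a * t + r , (begin
  + 0 + (a * du (eval (a +ε b) ds) + b * r)   ≡⟨ cong (λ d → + 0 + (a * d + b * r)) du≡bt ⟩
  + 0 + (a * (b * t) + b * r)                 ≡⟨ factor r ⟩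
  b * (a * t + r)                             ∎)
  where
  open ≡-Reasoning
  r : ℤ
  r = re (eval (a +ε b) ds)
  factor : ∀ R → + 0 + (a * (b * t) + b * R) ≡ b * (a * t + R)
  factor R = solve (a ∷ b ∷ t ∷ R ∷ [])

necessity : ∀ q → IsNumberSystem q (𝔑₀ q) →
            ∃ λ (a : ℤ) → (a ≤ - (+ 2)) × ((q ≡ a +ε (+ 1)) ⊎ (q ≡ a +ε (- (+ 1))))
necessity ((+ _) +ε b) (_ , expansions) with expansions (-1ℤ +ε 0ℤ)
... | ds , digits , -1≡ =
  ⊥-elim (0≰-[1+n] (subst (0ℤ ≤_) (sym (cong re -1≡)) (re-eval-nonneg ds (+≤+ ℕ.z≤n) digits)))
necessity (-[1+ 0 ] +ε b) (_ , expansions) with expansions (1ℤ +ε 0ℤ)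
... | ds , digits , 1≡ with trans (cong re 1≡) (re-eval≡0 ds digits)
... | ()
necessity (-[1+ suc k ] +ε b) (_ , expansions) with expansions (0ℤ +ε 1ℤ)
... | ds , digits , ε≡ with du-eval-multiple ds digits
... | t , du≡bt = -[1+ suc k ] , -≤- (ℕ.s≤s ℕ.z≤n) ,
  Sum.map (cong (-[1+ suc k ] +ε_)) (cong (-[1+ suc k ] +ε_)) (∣i∣≡1⇒i≡±1 b ∣b∣≡1)
  where
  ∣b∣≡1 : ∣ b ∣ ≡ 1
  ∣b∣≡1 = ℕ.m*n≡1⇒m≡1 ∣ b ∣ ∣ t ∣ (trans (sym (abs-* b t)) (cong ∣_∣ (sym (trans (cong du ε≡) du≡bt))))

+Nrm≡re*re : ∀ a b → + Nrm (a +ε b) ≡ a * a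
+Nrm≡re*re a b with +∣i∣≡i⊎+∣i∣≡-i a
... | inj₁ +∣a∣≡a = trans (pos-* ∣ a ∣ ∣ a ∣) (cong₂ _*_ +∣a∣≡a +∣a∣≡a)
... | inj₂ +∣a∣≡-a = begin
  + (∣ a ∣ ℕ.* ∣ a ∣)   ≡⟨ pos-* ∣ a ∣ ∣ a ∣ ⟩
  + ∣ a ∣ * + ∣ a ∣     ≡⟨ cong₂ _*_ +∣a∣≡-a +∣a∣≡-a ⟩
  - a * - a             ≡⟨ solve (a ∷ []) ⟩
  a * a                 ∎
  where open ≡-Reasoning

∣ε-char : ∀ a x y → (a +ε (+ 1)) ∣ε (x +ε y) ⇔ ∃ λ t → x - a * y ≡ t * (a * a)
∣ε-char a x y = mk⇔ to from
  where
  open ≡-Reasoning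
  to : (a +ε (+ 1)) ∣ε (x +ε y) → ∃ λ t → x - a * y ≡ t * (a * a)
  to (c +ε d , x+εy≡) = - d , (begin
    x - a * y                       ≡⟨ cong₂ (λ u v → u - a * v) (cong re x+εy≡) (cong du x+εy≡) ⟩
    a * c - a * (a * d + + 1 * c)   ≡⟨ solve (a ∷ c ∷ d ∷ []) ⟩
    - d * (a * a)                   ∎)
  from : (∃ λ t → x - a * y ≡ t * (a * a)) → (a +ε (+ 1)) ∣ε (x +ε y)
  from (t , x-ay≡) = (y + a * t) +ε (- t) , cong₂ _+ε_ x≡ (solve (a ∷ y ∷ t ∷ []))
    where
    x≡ : x ≡ a * (y + a * t)
    x≡ = begin
      x                     ≡⟨ solve (x ∷ y ∷ a ∷ []) ⟩
      (x - a * y) + a * y   ≡⟨ cong (_+ a * y) x-ay≡ ⟩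
      t * (a * a) + a * y   ≡⟨ solve (a ∷ y ∷ t ∷ []) ⟩
      a * (y + a * t)       ∎

module _ (a : ℤ) .{{_ : NonZero a}} where

  private
    q : ℤ[ε]
    q = a +ε (+ 1)
    instance
      Nrm-nonZero : ℕ.NonZero (Nrm q)
      Nrm-nonZero = ℕ.m*n≢0 ∣ a ∣ ∣ a ∣
    +Nrm≡a*a : + Nrm q ≡ a * a
    +Nrm≡a*a = +Nrm≡re*re a (+ 1)

  residue : ∀ α → ∃ λ n → n ℕ.< Nrm q × q ∣ε (α ⊖ ι (+ n))
  residue (x +ε y) = n , n%ℕd<d z (Nrm q) , Equivalence.from (∣ε-char a _ _) (t , z-n≡tD)
    where
    open ≡-Reasoning
    z t : ℤ
    z = x - a * y
    t = z /ℕ Nrm q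
    n : ℕ
    n = z %ℕ Nrm q
    rearrange : ∀ N T D → z ≡ N + T * D → x - N - a * (y - + 0) ≡ T * D
    rearrange N T D z≡ = begin
      x - N - a * (y - + 0)   ≡⟨ solve (x ∷ y ∷ a ∷ N ∷ []) ⟩
      (x - a * y) - N         ≡⟨ cong (_- N) z≡ ⟩
      N + T * D - N           ≡⟨ solve (N ∷ T ∷ D ∷ []) ⟩
      T * D                   ∎
    z-n≡tD : x - + n - a * (y - + 0) ≡ t * (a * a)
    z-n≡tD = trans (rearrange (+ n) t (+ Nrm q) (a≡a%ℕn+[a/ℕn]*n z (Nrm q)))
                   (cong (t *_) +Nrm≡a*a)

  residues-congruent : ∀ α n n′ → q ∣ε (α ⊖ ι (+ n)) → q ∣ε (α ⊖ ι (+ n′)) →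
                       ∃ λ s → + n′ ≡ + n + s * + Nrm q
  residues-congruent (x +ε y) n n′ q∣ q∣′ =
    let t , n≡ = Equivalence.to (∣ε-char a (x - + n) (y - + 0)) q∣
        t′ , n′≡ = Equivalence.to (∣ε-char a (x - + n′) (y - + 0)) q∣′
    in t - t′ , subtract (+ n) (+ n′) t t′ n≡ n′≡
    where
    open ≡-Reasoning
    subtract : ∀ N N′ T T′ → x - N - a * (y - + 0) ≡ T * (a * a) →
               x - N′ - a * (y - + 0) ≡ T′ * (a * a) → N′ ≡ N + (T - T′) * + Nrm q
    subtract N N′ T T′ N≡ N′≡ = begin
      N′                                                         ≡⟨ solve (x ∷ y ∷ a ∷ N ∷ N′ ∷ []) ⟩
      N + ((x - N - a * (y - + 0)) - (x - N′ - a * (y - + 0)))   ≡⟨ cong₂ (λ u v → N + (u - v)) N≡ N′≡ ⟩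
      N + (T * (a * a) - T′ * (a * a))                           ≡⟨ solve (N ∷ T ∷ T′ ∷ a ∷ []) ⟩
      N + (T - T′) * (a * a)                                     ≡⟨ cong (λ u → N + (T - T′) * u) +Nrm≡a*a ⟨
      N + (T - T′) * + Nrm q                                     ∎

  residue-system : CompleteResidueSystem q (𝔑₀ q)
  residue-system α = case residue α of λ where
    (n , n<N , q∣) → ι (+ n) , (n , n<N , refl) , q∣ , λ where
      _ (n′ , n′<N , refl) q∣′ →
        cong (ι ∘ +_) (uncurry (λ s → residue-unique s n′<N n<N) (residues-congruent α n n′ q∣ q∣′))

module Expansion (M : ℤ) (2≤M : + 2 ≤ M) where

  private
    q : ℤ[ε]
    q = (- M) +ε (+ 1)

    0<M : 0ℤ < M
    0<M = <-≤-trans (+<+ (ℕ.s≤s ℕ.z≤n)) 2≤M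

    instance
      M-positive : Positive M
      M-positive = ℤ.positive 0<M
      M-nonNegative : ℤ.NonNegative M
      M-nonNegative = ℤ.nonNegative (<⇒≤ 0<M)

  -- x + εy = digit + q (x′ + εy′), in coordinates
  record Division (x y : ℤ) : Set where
    constructor division
    field
      digit x′ y′ : ℤ
      0≤digit : 0ℤ ≤ digit
      digit<M² : digit < M * M
      x-eq : M * x′ ≡ digit - x
      y-eq : M * y′ ≡ x′ - y

  +Nrm≡M*M : + Nrm q ≡ M * M
  +Nrm≡M*M = trans (+Nrm≡re*re (- M) (+ 1)) (solve (M ∷ []))

  private
    instance
      -M-nonZero : NonZero (- M)
      -M-nonZero = ℤ.<-nonZero (neg-mono-< 0<M)

  divide : ∀ x y → Division x y
  divide x y = case residue (- M) (x +ε y) of λ where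
      (n , n<N , (c +ε d , x+εy-n≡qγ)) →
        division (+ n) c d (+≤+ ℕ.z≤n) (subst (+ n <_) +Nrm≡M*M (+<+ n<N))
                 (x-eq (+ n) c (cong re x+εy-n≡qγ)) (y-eq c d (cong du x+εy-n≡qγ))
    where
    open ≡-Reasoning
    x-eq : ∀ N c → x - N ≡ - M * c → M * c ≡ N - x
    x-eq N c x-N≡ = begin
      M * c         ≡⟨ solve (M ∷ c ∷ []) ⟩
      - (- M * c)   ≡⟨ cong -_ x-N≡ ⟨
      - (x - N)     ≡⟨ solve (x ∷ N ∷ []) ⟩
      N - x         ∎
    y-eq : ∀ c d → y - + 0 ≡ - M * d + + 1 * c → M * d ≡ c - y
    y-eq c d y≡ = begin
      M * d                         ≡⟨ solve (M ∷ c ∷ d ∷ []) ⟩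
      c - (- M * d + + 1 * c)       ≡⟨ cong (_-_ c) y≡ ⟨
      c - (y - + 0)                 ≡⟨ solve (c ∷ y ∷ []) ⟩
      c - y                         ∎

  quotient : ∀ {x y} → Division x y → ℤ[ε]
  quotient d = Division.x′ d +ε Division.y′ d

  prepend-digit : ∀ {x y} (d : Division x y) → Representable q (quotient d) → Representable q (x +ε y)
  prepend-digit (division -[1+ _ ] _ _ () _ _ _)
  prepend-digit {x} {y} (division (+ n) x′ y′ _ n<M² x-eq y-eq) (ds , digits , e) =
    ι (+ n) ∷ ds , (n , n<N , refl) All.∷ digits ,
    trans (cong₂ _+ε_ x≡ y≡) (cong (λ β → ι (+ n) ⊕ q ⊛ β) e)
    where
    open ≡-Reasoning
    n<N : n ℕ.< Nrm q
    n<N = drop‿+<+ (subst (+ n <_) (sym +Nrm≡M*M) n<M²)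
    x≡ : x ≡ + n + - M * x′
    x≡ = shift (+ n) x-eq
      where
      shift : ∀ N → M * x′ ≡ N - x → x ≡ N + - M * x′
      shift N e = begin
        x               ≡⟨ solve (x ∷ N ∷ []) ⟩
        N - (N - x)     ≡⟨ cong (_-_ N) e ⟨
        N - M * x′      ≡⟨ solve (N ∷ M ∷ x′ ∷ []) ⟩
        N + - M * x′    ∎
    y≡ : y ≡ + 0 + (- M * y′ + + 1 * x′)
    y≡ = begin
      y                             ≡⟨ solve (x′ ∷ y ∷ []) ⟩
      x′ - (x′ - y)                 ≡⟨ cong (_-_ x′) y-eq ⟨
      x′ - M * y′                   ≡⟨ solve (M ∷ x′ ∷ y′ ∷ []) ⟩
      + 0 + (- M * y′ + + 1 * x′)   ∎

  halve : ∀ {s f} → M * + s ≤ + f → s ℕ.+ s ℕ.≤ f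
  halve {s} {f} Ms≤f = drop‿+≤+ (begin
    + s + + s   ≡⟨ double (+ s) ⟩
    + 2 * + s   ≤⟨ *-monoʳ-≤-nonNeg (+ s) 2≤M ⟩
    M * + s     ≤⟨ Ms≤f ⟩
    + f         ∎)
    where
    open ≤-Reasoning
    double : ∀ S → S + S ≡ + 2 * S
    double S = solve (S ∷ [])

  shrink : ∀ {t f} → M * t ≤ + f → t ≤ + ℕ.pred f
  shrink { -[1+ _ ]} _ = -≤+
  shrink {+ _} Mt≤f = +≤+ (half≤pred (halve Mt≤f))

  Near : ℕ → ℤ → Set
  Near f x = (-1ℤ - x ≤ + f) × (x - M ≤ + f)

  near-quotient : ∀ {f x y} (d : Division x y) → Near f x → Near (ℕ.pred f) (Division.x′ d)
  near-quotient {x = x} (division e x′ _ 0≤e e<M² x-eq _) (lo , hi) =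
    shrink (≤-trans below hi) , shrink (≤-trans above lo)
    where
    open ≡-Reasoning
    below : M * (-1ℤ - x′) ≤ x - M
    below = ≤-by-nonpos (begin
      M * (-1ℤ - x′)    ≡⟨ solve (M ∷ x′ ∷ []) ⟩
      - M - M * x′      ≡⟨ cong (_-_ (- M)) x-eq ⟩
      - M - (e - x)     ≡⟨ solve (M ∷ e ∷ x ∷ []) ⟩
      - e + (x - M)     ∎) (neg-mono-≤ 0≤e)
    above : M * (x′ - M) ≤ -1ℤ - x
    above = ≤-by-nonpos (begin
      M * (x′ - M)                   ≡⟨ solve (M ∷ x′ ∷ []) ⟩
      M * x′ - M * M                 ≡⟨ cong (_- M * M) x-eq ⟩
      e - x - M * M                  ≡⟨ solve (M ∷ e ∷ x ∷ []) ⟩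
      (1ℤ + e - M * M) + (-1ℤ - x)   ∎) (i≤j⇒i-j≤0 (i<j⇒suc[i]≤j e<M²))

  y′-lower : ∀ {x y} (d : Division x y) → Near 0 (Division.x′ d) → M * (- Division.y′ d) ≤ 1ℤ + y
  y′-lower {y = y} (division _ x′ y′ _ _ _ y-eq) (lo , _) = ≤-by-nonpos (begin
    M * (- y′)               ≡⟨ solve (M ∷ y′ ∷ []) ⟩
    - (M * y′)               ≡⟨ cong -_ y-eq ⟩
    - (x′ - y)               ≡⟨ solve (x′ ∷ y ∷ []) ⟩
    (-1ℤ - x′) + (1ℤ + y)    ∎) lo
    where open ≡-Reasoning

  y′-upper : ∀ {x y} (d : Division x y) → Near 0 (Division.x′ d) → M * (Division.y′ d - 1ℤ) ≤ - y
  y′-upper {y = y} (division _ x′ y′ _ _ _ y-eq) (_ , hi) = ≤-by-nonpos (begin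
    M * (y′ - 1ℤ)            ≡⟨ solve (M ∷ y′ ∷ []) ⟩
    M * y′ - M               ≡⟨ cong (_- M) y-eq ⟩
    x′ - y - M               ≡⟨ solve (M ∷ x′ ∷ y ∷ []) ⟩
    (x′ - M) + (- y)         ∎) hi
    where open ≡-Reasoning

  private
    1≤M : 1ℤ ≤ M
    1≤M = ≤-trans (+≤+ (ℕ.s≤s ℕ.z≤n)) 2≤M

    M+M≤M*M : M + M ≤ M * M
    M+M≤M*M = begin
      M + M       ≡⟨ solve (M ∷ []) ⟩
      + 2 * M     ≤⟨ *-monoʳ-≤-nonNeg M 2≤M ⟩
      M * M       ∎
      where open ≤-Reasoning

    M<M*M : M < M * M
    M<M*M = <-≤-trans (subst (_< M + M) (+-identityˡ M) (+-monoˡ-< M 0<M)) M+M≤M*M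

    1<M*M : 1ℤ < M * M
    1<M*M = ≤-<-trans 1≤M M<M*M

  digit-representable : ∀ {x} → 0ℤ ≤ x → x < M * M → Representable q (x +ε 0ℤ)
  digit-representable {x} 0≤x x<M² =
    prepend-digit {x} {0ℤ} (division x 0ℤ 0ℤ 0≤x x<M² (solve (M ∷ x ∷ [])) (solve (M ∷ [])))
                  ([] , All.[] , refl)

  representable-x+ε : ∀ {x} → 0ℤ ≤ x + M → x + M < M * M → Representable q (x +ε 1ℤ)
  representable-x+ε {x} lo hi =
    prepend-digit {x} {1ℤ} (division (x + M) 1ℤ 0ℤ lo hi (solve (M ∷ x ∷ [])) (solve (M ∷ [])))
           (digit-representable (+≤+ ℕ.z≤n) 1<M*M)

  representable-x-ε : ∀ {x} → -1ℤ ≤ x → x < M → Representable q (x +ε -1ℤ)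
  representable-x-ε {x} -1≤x x<M =
    prepend-digit {x} { -1ℤ}
      (division (x + M * M - M) (M - 1ℤ) 1ℤ lo hi (solve (M ∷ x ∷ [])) (solve (M ∷ [])))
      (representable-x+ε lo′ hi′)
    where
    open ≤-Reasoning
    lo : 0ℤ ≤ x + M * M - M
    lo = begin
      0ℤ                 ≤⟨ +-mono-≤ -1≤x 1≤M ⟩
      x + M              ≡⟨ solve (x ∷ M ∷ []) ⟩
      x + (M + M) - M    ≤⟨ +-monoˡ-≤ (- M) (+-monoʳ-≤ x M+M≤M*M) ⟩
      x + M * M - M      ∎
    hi : x + M * M - M < M * M
    hi = begin-strict
      x + M * M - M      <⟨ +-monoˡ-< (- M) (+-monoˡ-< (M * M) x<M) ⟩
      M + M * M - M      ≡⟨ solve (M ∷ []) ⟩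
      M * M              ∎
    lo′ : 0ℤ ≤ M - 1ℤ + M
    lo′ = +-mono-≤ (i≤j⇒0≤j-i 1≤M) (<⇒≤ 0<M)
    hi′ : M - 1ℤ + M < M * M
    hi′ = begin-strict
      M - 1ℤ + M         ≡⟨ solve (M ∷ []) ⟩
      (M + M) - 1ℤ       <⟨ i-1<i (M + M) ⟩
      M + M              ≤⟨ M+M≤M*M ⟩
      M * M              ∎

  strip-representable-x+ε : ∀ {x} → -1ℤ ≤ x → x ≤ M → Representable q (x +ε 1ℤ)
  strip-representable-x+ε {x} -1≤x x≤M with x + M <? M * M
  ... | yes x+M<M² = representable-x+ε (+-mono-≤ -1≤x 1≤M) x+M<M²
  ... | no x+M≮M² =  -- only for M = x = 2, whose quotient is -1 - ε
    prepend-digit {x} {1ℤ}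
      (division (x + M - M * M) (1ℤ - M) -1ℤ (i≤j⇒0≤j-i M²≤x+M) hi (solve (M ∷ x ∷ [])) (solve (M ∷ [])))
      (representable-x-ε lo′ (≤-<-trans (i≤j⇒i-j≤0 1≤M) 0<M))
    where
    open ≤-Reasoning
    M²≤x+M : M * M ≤ x + M
    M²≤x+M = ≮⇒≥ x+M≮M²
    x+M≤M+M : x + M ≤ M + M
    x+M≤M+M = +-monoˡ-≤ M x≤M
    hi : x + M - M * M < M * M
    hi = ≤-<-trans (i≤j⇒i-j≤0 (≤-trans x+M≤M+M M+M≤M*M)) (<-trans 0<M M<M*M)
    M≤2 : M ≤ + 2
    M≤2 = *-cancelˡ-≤-pos M (+ 2) M (begin
      M * M      ≤⟨ M²≤x+M ⟩
      x + M      ≤⟨ x+M≤M+M ⟩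
      M + M      ≡⟨ solve (M ∷ []) ⟩
      M * + 2    ∎)
    lo′ : -1ℤ ≤ 1ℤ - M
    lo′ = +-monoʳ-≤ 1ℤ (neg-mono-≤ M≤2)

  strip-representable-x : ∀ {x} → -1ℤ ≤ x → x ≤ M → Representable q (x +ε 0ℤ)
  strip-representable-x {+ n} _ x≤M = digit-representable (+≤+ ℕ.z≤n) (≤-<-trans x≤M M<M*M)
  strip-representable-x { -[1+ suc _ ]} (-≤- ()) _
  strip-representable-x { -[1+ 0 ]} _ _ =
    prepend-digit { -1ℤ} {0ℤ}
      (division (M * M - 1ℤ) M 1ℤ (i≤j⇒0≤j-i (<⇒≤ 1<M*M)) (i-1<i (M * M)) (solve (M ∷ [])) (solve (M ∷ [])))
      (strip-representable-x+ε (≤-trans (-≤+ {0} {0}) (<⇒≤ 0<M)) ≤-refl)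

  private
    0≤M*+n : ∀ n → 0ℤ ≤ M * + n
    0≤M*+n n = subst (_≤ M * + n) (*-zeroʳ M) (*-monoˡ-≤-nonNeg M (+≤+ ℕ.z≤n))

    strip-bounds : ∀ {x} → Near 0 x → -1ℤ ≤ x × x ≤ M
    strip-bounds (lo , hi) = i-j≤0⇒i≤j lo , i-j≤0⇒i≤j hi

  -- On the strip a digit step sends y ≥ 2 into [1 - y, 0] and y ≤ -1 into [0, -y], so the
  -- fuel f, bounding y within [-1 - f, 1 + f], drops at least every second step.
  strip-representable-nonneg : ∀ f j {x} → Near 0 x → j ℕ.≤ suc f → Representable q (x +ε (+ j))
  strip-representable-neg : ∀ f i {x} → Near 0 x → i ℕ.≤ f → Representable q (x +ε -[1+ i ])

  strip-representable-nonneg f 0 near _ = uncurry strip-representable-x (strip-bounds near)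
  strip-representable-nonneg f 1 near _ = uncurry strip-representable-x+ε (strip-bounds near)
  strip-representable-nonneg zero (suc (suc j)) _ (ℕ.s≤s ())
  strip-representable-nonneg (suc f) (suc (suc j)) {x} near (ℕ.s≤s (ℕ.s≤s j≤f)) =
    case divide x (+ suc (suc j)) of λ where
      d@(division _ _ (+ 0) _ _ _ _) →
        prepend-digit d (strip-representable-nonneg f 0 (near-quotient d near) ℕ.z≤n)
      d@(division _ _ +[1+ s ] _ _ _ _) →
        ⊥-elim (0≰-[1+n] (≤-trans (0≤M*+n s) (y′-upper d (near-quotient d near))))
      d@(division _ _ -[1+ i ] _ _ _ _) →
        prepend-digit d (strip-representable-neg f i (near-quotient d near)
                    (ℕ.≤-trans (2+2i≤3+j⇒i≤j (halve (y′-lower d (near-quotient d near)))) j≤f))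

  strip-representable-neg f i {x} near i≤f = case divide x -[1+ i ] of λ where
    d@(division _ _ (+ 0) _ _ _ _) →
      prepend-digit d (strip-representable-nonneg f 0 (near-quotient d near) ℕ.z≤n)
    d@(division _ _ +[1+ j ] _ _ _ _) →
      prepend-digit d (strip-representable-nonneg f (suc j) (near-quotient d near)
                  (ℕ.s≤s (ℕ.≤-trans (drop‿+≤+ (shrink (y′-upper d (near-quotient d near)))) i≤f)))
    d@(division _ _ -[1+ s ] _ _ _ _) →
      ⊥-elim (1+n≰0 (shrink (≤-trans (y′-lower d (near-quotient d near))
                                      (+-monoʳ-≤ 1ℤ (-≤- {i} {0} ℕ.z≤n)))))

  strip-representable : ∀ {x} y → Near 0 x → Representable q (x +ε y)
  strip-representable (+ j) near = strip-representable-nonneg j j near (ℕ.n≤1+n j)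
  strip-representable -[1+ i ] near = strip-representable-neg i i near ℕ.≤-refl

  near-representable : ∀ f {x} y → Near f x → Representable q (x +ε y)
  near-representable zero y near = strip-representable y near
  near-representable (suc f) {x} y near =
    prepend-digit d (near-representable f (Division.y′ d) (near-quotient d near))
    where
    d : Division x y
    d = divide x y

  representable : ∀ α → Representable q α
  representable (x +ε y) = near-representable ∣ x ∣ y (lo , hi)
    where
    open ≤-Reasoning
    lo : -1ℤ - x ≤ + ∣ x ∣
    lo = begin
      -1ℤ - x           ≤⟨ +-monoˡ-≤ (- x) (-≤+ {0} {0}) ⟩
      0ℤ - x            ≡⟨ +-identityˡ (- x) ⟩
      - x               ≤⟨ i≤+∣i∣ (- x) ⟩
      + ∣ - x ∣         ≡⟨ cong +_ (∣-i∣≡∣i∣ x) ⟩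
      + ∣ x ∣           ∎
    hi : x - M ≤ + ∣ x ∣
    hi = ≤-trans (i-j≤i x M) (i≤+∣i∣ x)

  number-system : IsNumberSystem q (𝔑₀ q)
  number-system = residue-system (- M) , representable

sufficiency : ∀ q → (∃ λ (a : ℤ) → (a ≤ - (+ 2)) × ((q ≡ a +ε (+ 1)) ⊎ (q ≡ a +ε (- (+ 1))))) →
              IsNumberSystem q (𝔑₀ q)
sufficiency _ (+ _ , () , _)
sufficiency _ (-[1+ 0 ] , -≤- () , _)
sufficiency _ (-[1+ suc k ] , _ , inj₁ refl) = number-system
  where open Expansion (+ suc (suc k)) (+≤+ (ℕ.s≤s (ℕ.s≤s ℕ.z≤n)))
sufficiency _ (-[1+ suc k ] , _ , inj₂ refl) = number-system-conj _ number-system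
  where open Expansion (+ suc (suc k)) (+≤+ (ℕ.s≤s (ℕ.s≤s ℕ.z≤n)))

theorem4 : (q : ℤ[ε]) →
    IsNumberSystem q (𝔑₀ q) ⇔
      (∃ λ (a : ℤ) → (a ≤ - (+ 2)) × ((q ≡ a +ε (+ 1)) ⊎ (q ≡ a +ε (- (+ 1)))))
theorem4 q = mk⇔ (necessity q) (sufficiency q)
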